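{- For $n\geq 3$, $\mathcal{Z}(C_n;x)=\sum_{i=2}^n\left(\binom{n}{i}-\frac{n}{i}\binom{n-i-1}{i-1}\right)x^i$.
   Context: $C_n$ is the cycle on $n$ vertices. Zero forcing: given a set of colored vertices of a graph, a colored vertex $u$ with exactly one uncolored neighbor $v$ may force $v$, i.e. $v$ becomes colored. A set $S$ of vertices is a zero forcing set if starting with $S$ colored and repeatedly applying this rule eventually colors all vertices. For a graph $G$ on $n$ vertices, $z(G;i)$ is the number of zero forcing sets of size $i$ and $\mathcal{Z}(G;x)=\sum_{i=1}^n z(G;i)x^i$. Convention: $\binom{a}{b}=0$ whenever $a<b$ (including when $a$ is negative). -}

module Defs where

open import Data.Bool using (Bool; true; false; _∧_; _∨_; not; if_then_else_)
open import Data.Nat using (ℕ; zero; suc; _+_; _∸_; _%_; _≡ᵇ_)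
open import Data.Nat.Combinatorics using (_C_)
open import Data.Fin using (Fin; toℕ; _≟_)
open import Data.List using (List; []; _∷_; map; _++_; length; filter; allFin)
open import Data.List.Relation.Unary.Any using () renaming (any? to anyL?)
open import Data.Vec.Functional using (Vector)
open import Data.Integer using (ℤ; +_; -[1+_])
open import Relation.Nullary.Decidable using (⌊_⌋)
open import Relation.Binary.PropositionalEquality using (_≡_)
open import Data.Rational as ℚ using (ℚ)

Graph : ℕ → Set
Graph n = Fin n → Fin n → Bool

VSet : ℕ → Set
VSet n = Fin n → Bool

anyFin : ∀ {n} → (Fin n → Bool) → Bool
anyFin {n} p = Data.List.foldr (λ x b → p x ∨ b) false (allFin n)

allFin? : ∀ {n} → (Fin n → Bool) → Bool
allFin? {n} p = Data.List.foldr (λ x b → p x ∧ b) true (allFin n)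

-- The cycle C_n on vertices 0,…,n-1: i ~ j iff j ≡ i+1 (mod n) or i ≡ j+1 (mod n).
-- (Intended for n ≥ 3, where this is the simple cycle.)
cycleG : (n : ℕ) → Graph n
cycleG (suc m) i j =
  ((toℕ j) ≡ᵇ ((suc (toℕ i)) % suc m)) ∨ ((toℕ i) ≡ᵇ ((suc (toℕ j)) % suc m))
cycleG zero () j

canForce : ∀ {n} → Graph n → VSet n → Fin n → Fin n → Bool
canForce G S u v =
  S u ∧ not (S v) ∧ G u v ∧
  allFin? (λ w → not (G u w) ∨ S w ∨ ⌊ w ≟ v ⌋)

step : ∀ {n} → Graph n → VSet n → VSet n
step G S v = S v ∨ anyFin (λ u → canForce G S u v)

iterate : ∀ {n} → ℕ → Graph n → VSet n → VSet n
iterate zero    G S = S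
iterate (suc k) G S = iterate k G (step G S)

-- Final colouring obtained by repeatedly applying the colour change rule
-- (n rounds suffice: each round that changes anything colours a new vertex,
-- and the final colouring is independent of the order of forces).
closure : ∀ {n} → Graph n → VSet n → VSet n
closure {n} G S = iterate n G S

isZeroForcing : ∀ {n} → Graph n → VSet n → Bool
isZeroForcing G S = allFin? (closure G S)

size : ∀ {n} → VSet n → ℕ
size {n} S = length (filter (λ v → S v Data.Bool.≟ true) (allFin n))

allSets : (n : ℕ) → List (VSet n)
allSets zero    = (λ ()) ∷ []
allSets (suc n) =
  map (λ S → λ { Fin.zero → false ; (Fin.suc v) → S v }) (allSets n) ++
  map (λ S → λ { Fin.zero → true  ; (Fin.suc v) → S v }) (allSets n)

zfCount : ∀ {n} → Graph n → ℕ → ℕ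
zfCount {n} G i =
  length (filter (λ S → (isZeroForcing G S ∧ (size S ≡ᵇ i)) Data.Bool.≟ true) (allSets n))

-- Binomial coefficient with integer top, zero when the top is negative
-- (convention: binom a b = 0 whenever a < b).
binomℤ : ℤ → ℕ → ℕ
binomℤ (+ a)    b = a C b
binomℤ -[1+ _ ] b = 0

module Submission where

-- On a cycle of length at least 3 a vertex set is zero forcing exactly when it
-- contains two consecutive vertices: then the coloured arc grows by one vertex per
-- round, while in an independent set every coloured vertex has two uncoloured
-- neighbours, so nothing is ever forced.  Hence z(C_n; i) = C(n, i) minus the number
-- of independent i-sets of C_n, and those satisfy i·#independent = n·C(n−i−1, i−1).

open import Defs
open import Data.Nat using (ℕ)

module BitStrings where
  open import Data.Bool using (Bool; true; false; _∧_; not; if_then_else_)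
  import Data.Bool as Bool
  open import Data.Nat using (ℕ; zero; suc; _+_; _≡ᵇ_)
  open import Data.Nat.Properties using (+-suc; +-comm)
  open import Data.Nat.Combinatorics using (_C_; nCk+nC[k+1]≡[n+1]C[k+1])
  open import Data.List using (List; []; _∷_; _++_; map; length; filter; allFin)
  open import Data.List.Properties using (map-++; map-∘; map-tabulate)
  open import Data.Vec.Functional using (toList)
  open import Relation.Binary.PropositionalEquality
  open import Function using (_∘′_)

  count : {A : Set} → (A → Bool) → List A → ℕ
  count p []       = 0
  count p (x ∷ xs) = if p x then suc (count p xs) else count p xs

  length-filter≡count : {A : Set} (p : A → Bool) (xs : List A) →
                        length (filter (λ x → p x Bool.≟ true) xs) ≡ count p xs
  length-filter≡count p []       = refl
  length-filter≡count p (x ∷ xs) with p x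
  ... | true  = cong suc (length-filter≡count p xs)
  ... | false = length-filter≡count p xs

  count-++ : {A : Set} (p : A → Bool) (xs ys : List A) →
             count p (xs ++ ys) ≡ count p xs + count p ys
  count-++ p []       ys = refl
  count-++ p (x ∷ xs) ys with p x
  ... | true  = cong suc (count-++ p xs ys)
  ... | false = count-++ p xs ys

  count-map : {A B : Set} (p : B → Bool) (f : A → B) (xs : List A) →
              count p (map f xs) ≡ count (λ x → p (f x)) xs
  count-map p f []       = refl
  count-map p f (x ∷ xs) with p (f x)
  ... | true  = cong suc (count-map p f xs)
  ... | false = count-map p f xs

  count-cong : {A : Set} {p q : A → Bool} → (∀ x → p x ≡ q x) → (xs : List A) →
               count p xs ≡ count q xs
  count-cong {p = p} {q} p≗q []       = refl
  count-cong {p = p} {q} p≗q (x ∷ xs) rewrite p≗q x with q x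
  ... | true  = cong suc (count-cong p≗q xs)
  ... | false = count-cong p≗q xs

  count-none : {A : Set} {p : A → Bool} → (∀ x → p x ≡ false) → (xs : List A) → count p xs ≡ 0
  count-none none []       = refl
  count-none none (x ∷ xs) rewrite none x = count-none none xs

  count-partition : {A : Set} (q c : A → Bool) (xs : List A) →
                    count (λ x → q x ∧ not (c x)) xs + count (λ x → q x ∧ c x) xs ≡ count q xs
  count-partition q c []       = refl
  count-partition q c (x ∷ xs) with q x | c x
  ... | true  | true  = trans (+-suc _ _) (cong suc (count-partition q c xs))
  ... | true  | false = cong suc (count-partition q c xs)
  ... | false | _     = count-partition q c xs

  bitStrings : ℕ → List (List Bool)
  bitStrings zero    = [] ∷ []
  bitStrings (suc n) = map (false ∷_) (bitStrings n) ++ map (true ∷_) (bitStrings n)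

  count-bitStrings : (n : ℕ) (g : List Bool → Bool) →
                     count g (bitStrings (suc n))
                       ≡ count (λ l → g (false ∷ l)) (bitStrings n) + count (λ l → g (true ∷ l)) (bitStrings n)
  count-bitStrings n g = begin
    count g (map (false ∷_) (bitStrings n) ++ map (true ∷_) (bitStrings n))
      ≡⟨ count-++ g (map (false ∷_) (bitStrings n)) _ ⟩
    count g (map (false ∷_) (bitStrings n)) + count g (map (true ∷_) (bitStrings n))
      ≡⟨ cong₂ _+_ (count-map g (false ∷_) (bitStrings n)) (count-map g (true ∷_) (bitStrings n)) ⟩
    count (λ l → g (false ∷ l)) (bitStrings n) + count (λ l → g (true ∷ l)) (bitStrings n) ∎
    where open ≡-Reasoning

  toList-allSets : (n : ℕ) → map toList (allSets n) ≡ bitStrings n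
  toList-allSets zero    = refl
  toList-allSets (suc n) = begin
    map toList (allSets (suc n))
      ≡⟨ map-++ toList (map _ (allSets n)) _ ⟩
    map toList (map _ (allSets n)) ++ map toList (map _ (allSets n))
      ≡⟨ cong₂ _++_ (sym (map-∘ (allSets n))) (sym (map-∘ (allSets n))) ⟩
    map ((false ∷_) ∘′ toList) (allSets n) ++ map ((true ∷_) ∘′ toList) (allSets n)
      ≡⟨ cong₂ _++_ (map-∘ (allSets n)) (map-∘ (allSets n)) ⟩
    map (false ∷_) (map toList (allSets n)) ++ map (true ∷_) (map toList (allSets n))
      ≡⟨ cong (λ L → map (false ∷_) L ++ map (true ∷_) L) (toList-allSets n) ⟩
    bitStrings (suc n) ∎
    where open ≡-Reasoning

  count-allSets : (n : ℕ) (g : List Bool → Bool) →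
                  count (λ S → g (toList S)) (allSets n) ≡ count g (bitStrings n)
  count-allSets n g = trans (sym (count-map g toList (allSets n))) (cong (count g) (toList-allSets n))

  ones : List Bool → ℕ
  ones = count (λ b → b)

  size≡ones : {n : ℕ} (S : VSet n) → size S ≡ ones (toList S)
  size≡ones {n} S = begin
    size S                     ≡⟨ length-filter≡count S (allFin n) ⟩
    count S (allFin n)         ≡⟨ sym (count-map (λ b → b) S (allFin n)) ⟩
    ones (map S (allFin n))    ≡⟨ cong ones (map-tabulate (λ v → v) S) ⟩
    ones (toList S)            ∎
    where open ≡-Reasoning

  count-ones : (n k : ℕ) → count (λ l → ones l ≡ᵇ k) (bitStrings n) ≡ n C k
  count-ones zero    zero    = refl
  count-ones zero    (suc k) = refl
  count-ones (suc n) zero    = trans (count-bitStrings n (λ l → ones l ≡ᵇ 0))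
                                     (cong₂ _+_ (count-ones n 0) (count-none (λ _ → refl) (bitStrings n)))
  count-ones (suc n) (suc k) = begin
    count (λ l → ones l ≡ᵇ suc k) (bitStrings (suc n))
      ≡⟨ count-bitStrings n (λ l → ones l ≡ᵇ suc k) ⟩
    count (λ l → ones l ≡ᵇ suc k) (bitStrings n) + count (λ l → ones l ≡ᵇ k) (bitStrings n)
      ≡⟨ cong₂ _+_ (count-ones n (suc k)) (count-ones n k) ⟩
    n C suc k + n C k
      ≡⟨ +-comm (n C suc k) (n C k) ⟩
    n C k + n C suc k
      ≡⟨ nCk+nC[k+1]≡[n+1]C[k+1] n k ⟩
    suc n C suc k ∎
    where open ≡-Reasoning

module Binomial where
  open import Data.Nat using (ℕ; zero; suc; _+_; _*_; _∸_; _≤_; z≤n; s≤s⁻¹)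
  open import Data.Nat.Properties
    using (_≤?_; ≰⇒>; <⇒≤; +-suc; +-∸-assoc; m∸n+n≡m; m≤n⇒m∸n≡0;
           *-zeroʳ; *-identityˡ; *-identityʳ; *-distribˡ-+; *-distribʳ-+)
  open import Data.Nat.Combinatorics using (_C_; nC1≡n; nCk+nC[k+1]≡[n+1]C[k+1])
  open import Data.Nat.Tactic.RingSolver using (solve-∀)
  open import Data.Sum using (_⊎_; inj₁)
  open import Relation.Nullary using (yes; no; contradiction)
  open import Relation.Binary.PropositionalEquality

  -- Pascal's rule with a truncated top: it fails only when the top 'suc x ∸ y' is
  -- truncated to 0 while k = 0, which the side condition excludes.
  pascal-∸ : (x y k : ℕ) → y ≤ x ⊎ 1 ≤ k →
             (suc x ∸ y) C suc k ≡ (x ∸ y) C k + (x ∸ y) C suc k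
  pascal-∸ x y k side with y ≤? x
  ... | yes y≤x rewrite +-∸-assoc 1 y≤x = sym (nCk+nC[k+1]≡[n+1]C[k+1] (x ∸ y) k)
  pascal-∸ x y zero    (inj₁ y≤x) | no y≰x = contradiction y≤x y≰x
  pascal-∸ x y (suc k) side       | no y≰x
    rewrite m≤n⇒m∸n≡0 (≰⇒> y≰x) | m≤n⇒m∸n≡0 (<⇒≤ (≰⇒> y≰x)) = refl

  absorption : (a k : ℕ) → suc k * (suc a C suc k) ≡ suc a * (a C k)
  absorption zero    zero    = refl
  absorption zero    (suc k) = *-zeroʳ (suc (suc k))
  absorption (suc a) zero    = trans (*-identityˡ _) (trans (nC1≡n (suc (suc a))) (sym (*-identityʳ _)))
  absorption (suc a) (suc k) = begin
    suc (suc k) * (suc (suc a) C suc (suc k))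
      ≡⟨ cong (suc (suc k) *_) (sym (nCk+nC[k+1]≡[n+1]C[k+1] (suc a) (suc k))) ⟩
    suc (suc k) * (P + Q)
      ≡⟨ expand k P Q ⟩
    P + suc k * P + suc (suc k) * Q
      ≡⟨ cong₂ (λ x y → P + x + y) (absorption a k) (absorption a (suc k)) ⟩
    P + suc a * (a C k) + suc a * (a C suc k)
      ≡⟨ collect a P (a C k) (a C suc k) ⟩
    P + suc a * (a C k + a C suc k)
      ≡⟨ cong (λ x → P + suc a * x) (nCk+nC[k+1]≡[n+1]C[k+1] a k) ⟩
    suc (suc a) * P ∎
    where
    open ≡-Reasoning
    P = suc a C suc k
    Q = suc a C suc (suc k)
    expand : ∀ k P Q → suc (suc k) * (P + Q) ≡ P + suc k * P + suc (suc k) * Q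
    expand = solve-∀
    collect : ∀ a P x y → P + suc a * x + suc a * y ≡ P + suc a * (x + y)
    collect = solve-∀

  -- (i+1)·(C(n+1−i, i+1) + C(n−i, i)) = (n+2)·C(n−i, i); for i > n both sides vanish.
  absorption-sum : (n i : ℕ) → suc i * ((suc n ∸ i) C suc i + (n ∸ i) C i) ≡ suc (suc n) * ((n ∸ i) C i)
  absorption-sum n i with i ≤? n
  ... | yes i≤n rewrite +-∸-assoc 1 i≤n = begin
    suc i * (suc a C suc i + a C i)            ≡⟨ *-distribˡ-+ (suc i) (suc a C suc i) (a C i) ⟩
    suc i * (suc a C suc i) + suc i * (a C i)  ≡⟨ cong (_+ suc i * (a C i)) (absorption a i) ⟩
    suc a * (a C i) + suc i * (a C i)          ≡⟨ sym (*-distribʳ-+ (a C i) (suc a) (suc i)) ⟩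
    (suc a + suc i) * (a C i)                  ≡⟨ cong (λ x → suc x * (a C i)) a+1+i≡1+n ⟩
    suc (suc n) * (a C i)                      ∎
    where
    open ≡-Reasoning
    a = n ∸ i
    a+1+i≡1+n : a + suc i ≡ suc n
    a+1+i≡1+n = trans (+-suc a i) (cong suc (m∸n+n≡m i≤n))
  absorption-sum n zero    | no 0≰n = contradiction z≤n 0≰n
  absorption-sum n (suc i) | no i≰n
    rewrite m≤n⇒m∸n≡0 (s≤s⁻¹ (≰⇒> i≰n)) | m≤n⇒m∸n≡0 (<⇒≤ (≰⇒> i≰n)) =
      trans (*-zeroʳ (suc (suc i))) (sym (*-zeroʳ (suc (suc n))))

module IndependentStrings where
  open import Data.Bool using (Bool; true; false; _∧_; not)
  open import Data.Bool.Properties using (∧-zeroʳ)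
  open import Data.Nat using (ℕ; zero; suc; _+_; _*_; _∸_; _≤_; _<_; z≤n; s≤s; _≡ᵇ_)
  open import Data.Nat.Properties using (+-identityʳ; +-comm; m≤n⇒m∸n≡0; m≤n+m; m≤m+n; ≤-trans)
  open import Data.Nat.Combinatorics using (_C_)
  open import Data.Fin as Fin using (Fin; toℕ)
  open import Data.List using (List; []; _∷_; _++_)
  open import Data.Vec.Functional using (toList)
  open import Data.Product using (Σ; _×_; _,_)
  open import Data.Sum using (_⊎_; inj₁; inj₂)
  open import Relation.Binary.PropositionalEquality
  open BitStrings
  open Binomial

  -- A bit string is an independent set of the path s · l · e when no two
  -- consecutive bits of the string s ∷ l ++ [e] are both 1.
  pathIndependent : Bool → List Bool → Bool → Bool
  pathIndependent s []      e = not (s ∧ e)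
  pathIndependent s (b ∷ l) e = not (s ∧ b) ∧ pathIndependent b l e

  -- Independence in the cycle: the last bit is also adjacent to the first one.
  cycleIndependent : List Bool → Bool
  cycleIndependent []      = true
  cycleIndependent (b ∷ l) = pathIndependent b l b

  pathCount : ℕ → ℕ → Bool → Bool → ℕ
  pathCount n k s e = count (λ l → (ones l ≡ᵇ k) ∧ pathIndependent s l e) (bitStrings n)

  cycleCount : ℕ → ℕ → ℕ
  cycleCount n k = count (λ l → (ones l ≡ᵇ k) ∧ cycleIndependent l) (bitStrings n)

  bit : Bool → ℕ
  bit false = 0
  bit true  = 1

  -- The recursion of pathCount on the first bit of l: after a 1 the next bit must be 0.
  pathCount-after-one : (n k : ℕ) (e : Bool) → pathCount (suc n) k true e ≡ pathCount n k false e
  pathCount-after-one n k e =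
    trans (count-bitStrings n _)
          (trans (cong (pathCount n k false e +_) (count-none (λ l → ∧-zeroʳ _) (bitStrings n)))
                 (+-identityʳ _))

  -- With no ones left, the first bit must be 0.
  pathCount-no-ones : (n : ℕ) (e : Bool) → pathCount (suc n) 0 false e ≡ pathCount n 0 false e
  pathCount-no-ones n e =
    trans (count-bitStrings n _)
          (trans (cong (pathCount n 0 false e +_) (count-none (λ l → refl) (bitStrings n)))
                 (+-identityʳ _))

  -- Otherwise the first bit is 0 or 1, and a 1 spends one of the ones.
  pathCount-first-bit : (n k : ℕ) (e : Bool) →
                        pathCount (suc n) (suc k) false e ≡ pathCount n (suc k) false e + pathCount n k true e
  pathCount-first-bit n k e = count-bitStrings n _

  pathCount-closed : (n k : ℕ) (s e : Bool) → pathCount (suc n) k s e ≡ (suc (suc n) ∸ (bit s + k + bit e)) C k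
  pathCount-closed zero zero          false false = refl
  pathCount-closed zero zero          false true  = refl
  pathCount-closed zero zero          true  false = refl
  pathCount-closed zero zero          true  true  = refl
  pathCount-closed zero (suc zero)    false false = refl
  pathCount-closed zero (suc zero)    false true  = refl
  pathCount-closed zero (suc zero)    true  false = refl
  pathCount-closed zero (suc zero)    true  true  = refl
  pathCount-closed zero (suc (suc k)) s     e = sym (cong (_C suc (suc k)) (m≤n⇒m∸n≡0 two-ones))
    where
    -- a single free bit cannot carry two ones
    two-ones : 2 ≤ bit s + suc (suc k) + bit e
    two-ones = ≤-trans (s≤s (s≤s z≤n)) (≤-trans (m≤n+m (suc (suc k)) (bit s)) (m≤m+n _ (bit e)))
  pathCount-closed (suc n) k       true  e = trans (pathCount-after-one (suc n) k e) (pathCount-closed n k false e)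
  pathCount-closed (suc n) zero    false e = trans (pathCount-no-ones (suc n) e) (pathCount-closed n zero false e)
  pathCount-closed (suc n) (suc k) false e = begin
    pathCount (suc (suc n)) (suc k) false e
      ≡⟨ pathCount-first-bit (suc n) k e ⟩
    pathCount (suc n) (suc k) false e + pathCount (suc n) k true e
      ≡⟨ cong₂ _+_ (pathCount-closed n (suc k) false e) (pathCount-closed n k true e) ⟩
    (suc n ∸ (k + bit e)) C suc k + (suc n ∸ (k + bit e)) C k
      ≡⟨ +-comm ((suc n ∸ (k + bit e)) C suc k) _ ⟩
    (suc n ∸ (k + bit e)) C k + (suc n ∸ (k + bit e)) C suc k
      ≡⟨ sym (pascal-∸ (suc n) (k + bit e) k (k-or-ends-fit k e)) ⟩
    (suc (suc n) ∸ (k + bit e)) C suc k ∎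
    where
    open ≡-Reasoning
    k-or-ends-fit : (k : ℕ) (e : Bool) → k + bit e ≤ suc n ⊎ 1 ≤ k
    k-or-ends-fit zero    false = inj₁ z≤n
    k-or-ends-fit zero    true  = inj₁ (s≤s z≤n)
    k-or-ends-fit (suc k) e     = inj₂ (s≤s z≤n)

  -- Splitting on the first vertex: it is either unchosen (a path with free ends
  -- remains) or chosen (a path whose both ends are next to a chosen vertex remains).
  cycleCount-closed : (n i : ℕ) → cycleCount (suc (suc n)) (suc i) ≡ (suc n ∸ i) C suc i + (n ∸ i) C i
  cycleCount-closed n i = begin
    cycleCount (suc (suc n)) (suc i)
      ≡⟨ count-bitStrings (suc n) _ ⟩
    pathCount (suc n) (suc i) false false + pathCount (suc n) i true true
      ≡⟨ cong₂ _+_ (pathCount-closed n (suc i) false false) (pathCount-closed n i true true) ⟩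
    (suc n ∸ (i + 0)) C suc i + (suc n ∸ (i + 1)) C i
      ≡⟨ cong₂ (λ x y → (suc n ∸ x) C suc i + (suc n ∸ y) C i) (+-identityʳ i) (+-comm i 1) ⟩
    (suc n ∸ i) C suc i + (n ∸ i) C i ∎
    where open ≡-Reasoning

  cycleCount-identity : (n i : ℕ) → suc i * cycleCount (suc (suc n)) (suc i) ≡ suc (suc n) * ((n ∸ i) C i)
  cycleCount-identity n i = trans (cong (suc i *_) (cycleCount-closed n i)) (absorption-sum n i)

  -- The j-th bit of a string, read as 0 beyond its end.
  bitAt : List Bool → ℕ → Bool
  bitAt []      j       = false
  bitAt (b ∷ l) zero    = b
  bitAt (b ∷ l) (suc j) = bitAt l j

  ConsecutiveOnes : List Bool → Set
  ConsecutiveOnes L = Σ ℕ λ j → bitAt L j ≡ true × bitAt L (suc j) ≡ true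

  later : {b : Bool} {L : List Bool} → ConsecutiveOnes L → ConsecutiveOnes (b ∷ L)
  later (j , bj , bj+1) = suc j , bj , bj+1

  dependent-witness : (s : Bool) (l : List Bool) (e : Bool) → pathIndependent s l e ≡ false →
                      ConsecutiveOnes (s ∷ l ++ e ∷ [])
  dependent-witness true  []           true  _ = 0 , refl , refl
  dependent-witness true  (true  ∷ l)  e     _ = 0 , refl , refl
  dependent-witness true  (false ∷ l)  e     h = later (dependent-witness false l e h)
  dependent-witness false (b ∷ l)      e     h = later (dependent-witness b l e h)

  witness-dependent : (s : Bool) (l : List Bool) (e : Bool) (j : ℕ) →
                      bitAt (s ∷ l ++ e ∷ []) j ≡ true → bitAt (s ∷ l ++ e ∷ []) (suc j) ≡ true →
                      pathIndependent s l e ≡ false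
  witness-dependent s []      e zero    refl refl = refl
  witness-dependent s []      e (suc j) _    ()
  witness-dependent s (b ∷ l) e zero    refl refl = refl
  witness-dependent s (b ∷ l) e (suc j) bj   bj+1 rewrite witness-dependent b l e j bj bj+1 = ∧-zeroʳ _

  bitAt-vertex : {n : ℕ} (S : VSet n) (x : Bool) (u : Fin n) → bitAt (toList S ++ x ∷ []) (toℕ u) ≡ S u
  bitAt-vertex S x Fin.zero    = refl
  bitAt-vertex S x (Fin.suc u) = bitAt-vertex (λ v → S (Fin.suc v)) x u

  bitAt-last : (n : ℕ) (S : VSet n) (x : Bool) → bitAt (toList S ++ x ∷ []) n ≡ x
  bitAt-last zero    S x = refl
  bitAt-last (suc n) S x = bitAt-last n (λ v → S (Fin.suc v)) x

  bitAt-beyond : (n : ℕ) (S : VSet n) (x : Bool) {j : ℕ} → n < j → bitAt (toList S ++ x ∷ []) j ≡ false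
  bitAt-beyond zero    S x {suc j} _         = refl
  bitAt-beyond (suc n) S x {suc j} (s≤s n<j) = bitAt-beyond n (λ v → S (Fin.suc v)) x n<j

module ColourChange where
  open import Data.Bool using (Bool; true; false; _∧_; _∨_; not)
  open import Data.Bool.Properties using (∨-identityʳ; ∨-zeroʳ; ∧-conicalˡ; ∧-conicalʳ)
  open import Data.Nat using (ℕ)
  open import Data.Fin using (Fin; _≟_)
  open import Data.List using (List; []; _∷_; foldr; allFin)
  open import Data.List.Membership.Propositional using (_∈_)
  open import Data.List.Membership.Propositional.Properties using (∈-allFin)
  open import Data.List.Relation.Unary.Any using (here; there)
  open import Data.Sum using (_⊎_; inj₁; inj₂)
  open import Relation.Nullary using (Dec; yes; no; contradiction)
  open import Relation.Nullary.Decidable using (⌊_⌋)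
  open import Relation.Binary.PropositionalEquality

  allFin?-intro : {n : ℕ} (p : Fin n → Bool) → (∀ w → p w ≡ true) → allFin? p ≡ true
  allFin?-intro {n} p all = go (allFin n)
    where
    go : (xs : List (Fin n)) → foldr (λ x b → p x ∧ b) true xs ≡ true
    go []       = refl
    go (x ∷ xs) rewrite all x = go xs

  allFin?-elim : {n : ℕ} (p : Fin n → Bool) → allFin? p ≡ true → ∀ w → p w ≡ true
  allFin?-elim {n} p all w = go (∈-allFin w) all
    where
    go : {xs : List (Fin n)} → w ∈ xs → foldr (λ x b → p x ∧ b) true xs ≡ true → p w ≡ true
    go (here refl) h = ∧-conicalˡ _ _ h
    go (there w∈) h  = go w∈ (∧-conicalʳ _ _ h)

  anyFin-intro : {n : ℕ} (p : Fin n → Bool) (u : Fin n) → p u ≡ true → anyFin p ≡ true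
  anyFin-intro {n} p u pu = go (∈-allFin u)
    where
    go : {xs : List (Fin n)} → u ∈ xs → foldr (λ x b → p x ∨ b) false xs ≡ true
    go (here refl)            rewrite pu = refl
    go {x ∷ xs} (there u∈) rewrite go u∈ = ∨-zeroʳ (p x)

  anyFin-none : {n : ℕ} (p : Fin n → Bool) → (∀ u → p u ≡ false) → anyFin p ≡ false
  anyFin-none {n} p none = go (allFin n)
    where
    go : (xs : List (Fin n)) → foldr (λ x b → p x ∨ b) false xs ≡ false
    go []       = refl
    go (x ∷ xs) rewrite none x = go xs

  module _ {n : ℕ} (G : Graph n) (S : VSet n) where

    forcer-coloured : {u v : Fin n} → canForce G S u v ≡ true → S u ≡ true
    forcer-coloured h = ∧-conicalˡ _ _ h

    forced-unique : {u v w : Fin n} → canForce G S u v ≡ true → G u w ≡ true → S w ≡ false → w ≡ v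
    forced-unique {u} {v} {w} h Guw Sw =
      only-candidate (w ≟ v) (allFin?-elim (λ x → not (G u x) ∨ S x ∨ ⌊ x ≟ v ⌋) others-ok w)
      where
      others-ok : allFin? (λ x → not (G u x) ∨ S x ∨ ⌊ x ≟ v ⌋) ≡ true
      others-ok = ∧-conicalʳ (G u v) _ (∧-conicalʳ (not (S v)) _ (∧-conicalʳ (S u) _ h))
      only-candidate : (d : Dec (w ≡ v)) → not (G u w) ∨ S w ∨ ⌊ d ⌋ ≡ true → w ≡ v
      only-candidate (yes w≡v) _ = w≡v
      only-candidate (no _)    h rewrite Guw | Sw with () ← h

    step-stalled : (v : Fin n) → (∀ u → canForce G S u v ≡ false) → step G S v ≡ S v
    step-stalled v none = trans (cong (S v ∨_) (anyFin-none _ none)) (∨-identityʳ (S v))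

    step-extensive : (v : Fin n) → S v ≡ true → step G S v ≡ true
    step-extensive v Sv rewrite Sv = refl

    step-forces : {u v : Fin n} → S u ≡ true → G u v ≡ true →
                  (∀ w → G u w ≡ true → S w ≡ true ⊎ w ≡ v) → step G S v ≡ true
    step-forces {u} {v} Su Guv others = by-colour-of-v (S v) refl
      where
      neighbour-ok : ∀ w → not (G u w) ∨ S w ∨ ⌊ w ≟ v ⌋ ≡ true
      neighbour-ok w with G u w in Guw
      ... | false = refl
      ... | true with others w Guw
      ...   | inj₁ Sw  rewrite Sw = refl
      ...   | inj₂ w≡v with w ≟ v
      ...     | yes _    = ∨-zeroʳ (S w)
      ...     | no  w≢v  = contradiction w≡v w≢v
      by-colour-of-v : (b : Bool) → S v ≡ b → step G S v ≡ true
      by-colour-of-v true  Sv = step-extensive v Sv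
      by-colour-of-v false Sv = trans (cong (S v ∨_) (anyFin-intro _ u can-force)) (∨-zeroʳ (S v))
        where
        can-force : canForce G S u v ≡ true
        can-force rewrite Su | Sv | Guv = allFin?-intro _ neighbour-ok

module Cycle (m : ℕ) where
  open import Data.Bool using (Bool; true; false; not)
  open import Data.Bool.Properties using (∨-zeroʳ; T-≡; ¬-not; not-¬)
  open import Data.Nat using (ℕ; zero; suc; _+_; _*_; _∸_; _≤_; _≡ᵇ_; _%_; _/_; s≤s; s≤s⁻¹)
  open import Data.Nat.Properties
    using (_<?_; ≮⇒≥; ≤-refl; ≤-trans; <⇒≤; <⇒≱; n≤1+n; m≤m+n; m≤n⇒m<n∨m≡n; +-comm; +-suc;
           +-identityʳ; +-cancelˡ-≡; m+[n∸m]≡n; ≡⇒≡ᵇ; ≡ᵇ⇒≡)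
  open import Data.Nat.DivMod using (m%n<n; m<n⇒m%n≡m; n%n≡0; %-distribˡ-+; m%n%n≡m%n; [m+n]%n≡m%n; m≡m%n+[m/n]*n)
  open import Data.Fin as Fin using (Fin; toℕ; fromℕ<)
  open import Data.Fin.Properties using (toℕ-fromℕ<; toℕ-injective; toℕ<n)
  open import Data.Vec.Functional using (toList)
  open import Data.List using (List; _++_; _∷_; [])
  open import Data.Product using (Σ; _×_; _,_)
  open import Data.Sum using (_⊎_; inj₁; inj₂)
  open import Function using (Equivalence)
  open import Relation.Nullary using (yes; no; contradiction)
  open import Relation.Binary.PropositionalEquality
  open Equivalence using (to; from)

  N : ℕ
  N = suc m

  G : Graph N
  G = cycleG N

  next : Fin N → Fin N
  next u = fromℕ< (m%n<n (suc (toℕ u)) N)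

  toℕ-next : (u : Fin N) → toℕ (next u) ≡ suc (toℕ u) % N
  toℕ-next u = toℕ-fromℕ< _

  walk : ℕ → Fin N → Fin N
  walk zero    a = a
  walk (suc j) a = next (walk j a)

  +-%-absorb : (a b : ℕ) → (a + b % N) % N ≡ (a + b) % N
  +-%-absorb a b = begin
    (a + b % N) % N             ≡⟨ %-distribˡ-+ a (b % N) N ⟩
    (a % N + b % N % N) % N     ≡⟨ cong (λ x → (a % N + x) % N) (m%n%n≡m%n b N) ⟩
    (a % N + b % N) % N         ≡⟨ %-distribˡ-+ a b N ⟨
    (a + b) % N                 ∎
    where open ≡-Reasoning

  toℕ-walk : (j : ℕ) (a : Fin N) → toℕ (walk j a) ≡ (toℕ a + j) % N
  toℕ-walk zero    a = sym (trans (cong (_% N) (+-identityʳ (toℕ a))) (m<n⇒m%n≡m (toℕ<n a)))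
  toℕ-walk (suc j) a = begin
    toℕ (next (walk j a))       ≡⟨ toℕ-next (walk j a) ⟩
    suc (toℕ (walk j a)) % N    ≡⟨ cong (λ x → suc x % N) (toℕ-walk j a) ⟩
    (1 + (toℕ a + j) % N) % N   ≡⟨ +-%-absorb 1 (toℕ a + j) ⟩
    suc (toℕ a + j) % N         ≡⟨ cong (_% N) (+-suc (toℕ a) j) ⟨
    (toℕ a + suc j) % N         ∎
    where open ≡-Reasoning

  walk-next : (j : ℕ) (a : Fin N) → walk j (next a) ≡ next (walk j a)
  walk-next zero    a = refl
  walk-next (suc j) a = cong next (walk-next j a)

  walk-around : (a : Fin N) → walk N a ≡ a
  walk-around a = toℕ-injective (begin
    toℕ (walk N a)   ≡⟨ toℕ-walk N a ⟩
    (toℕ a + N) % N  ≡⟨ [m+n]%n≡m%n (toℕ a) N ⟩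
    toℕ a % N        ≡⟨ m<n⇒m%n≡m (toℕ<n a) ⟩
    toℕ a            ∎)
    where open ≡-Reasoning

  walk-reaches : (a v : Fin N) → Σ ℕ λ j → j ≤ m × walk j a ≡ v
  walk-reaches a v = j , s≤s⁻¹ (m%n<n (N + toℕ v ∸ toℕ a) N) , toℕ-injective (begin
    toℕ (walk j a)                      ≡⟨ toℕ-walk j a ⟩
    (toℕ a + j) % N                     ≡⟨ +-%-absorb (toℕ a) (N + toℕ v ∸ toℕ a) ⟩
    (toℕ a + (N + toℕ v ∸ toℕ a)) % N   ≡⟨ cong (_% N) (m+[n∸m]≡n a≤N+v) ⟩
    (N + toℕ v) % N                     ≡⟨ cong (_% N) (+-comm N (toℕ v)) ⟩
    (toℕ v + N) % N                     ≡⟨ [m+n]%n≡m%n (toℕ v) N ⟩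
    toℕ v % N                           ≡⟨ m<n⇒m%n≡m (toℕ<n v) ⟩
    toℕ v                               ∎)
    where
    open ≡-Reasoning
    j = (N + toℕ v ∸ toℕ a) % N
    a≤N+v : toℕ a ≤ N + toℕ v
    a≤N+v = ≤-trans (<⇒≤ (toℕ<n a)) (m≤m+n N (toℕ v))

  prev : Fin N → Fin N
  prev = walk m

  next-prev : (u : Fin N) → next (prev u) ≡ u
  next-prev = walk-around

  next-injective : {u v : Fin N} → next u ≡ next v → u ≡ v
  next-injective {u} {v} e = begin
    u                 ≡⟨ walk-around u ⟨
    next (walk m u)   ≡⟨ walk-next m u ⟨
    walk m (next u)   ≡⟨ cong (walk m) e ⟩
    walk m (next v)   ≡⟨ walk-next m v ⟩
    next (walk m v)   ≡⟨ walk-around v ⟩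
    v                 ∎
    where open ≡-Reasoning

  -- On a cycle of length at least 3, two steps never lead back: that would make
  -- 2 a multiple of the length.
  next²≢id : 2 ≤ m → (u : Fin N) → next (next u) ≢ u
  next²≢id 2≤m u e = no-multiple ((toℕ u + 2) / N) 2≡qN
    where
    a+2%N≡a : (toℕ u + 2) % N ≡ toℕ u
    a+2%N≡a = trans (sym (toℕ-walk 2 u)) (cong toℕ e)
    2≡qN : 2 ≡ (toℕ u + 2) / N * N
    2≡qN = +-cancelˡ-≡ (toℕ u) 2 _
             (trans (m≡m%n+[m/n]*n (toℕ u + 2) N) (cong (_+ (toℕ u + 2) / N * N) a+2%N≡a))
    no-multiple : (q : ℕ) → 2 ≢ q * N
    no-multiple zero    ()
    no-multiple (suc q) 2≡N+qN = <⇒≱ (s≤s 2≤m) (subst (N ≤_) (sym 2≡N+qN) (m≤m+n N (q * N)))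

  ≡ᵇ-complete : {x y : ℕ} → x ≡ y → (x ≡ᵇ y) ≡ true
  ≡ᵇ-complete {x} {y} e = to T-≡ (≡⇒≡ᵇ x y e)

  ≡ᵇ-sound : {x y : ℕ} → (x ≡ᵇ y) ≡ true → x ≡ y
  ≡ᵇ-sound {x} {y} h = ≡ᵇ⇒≡ x y (from T-≡ h)

  adjacent-next : (u : Fin N) → G u (next u) ≡ true
  adjacent-next u rewrite ≡ᵇ-complete (toℕ-next u) = refl

  adjacent-before : (w : Fin N) → G (next w) w ≡ true
  adjacent-before w rewrite ≡ᵇ-complete (toℕ-next w) = ∨-zeroʳ _

  adjacent-cases : {u w : Fin N} → G u w ≡ true → next u ≡ w ⊎ next w ≡ u
  adjacent-cases {u} {w} Guw with toℕ w ≡ᵇ suc (toℕ u) % N in forward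
  ... | true  = inj₁ (toℕ-injective (trans (toℕ-next u) (sym (≡ᵇ-sound forward))))
  ... | false = inj₂ (toℕ-injective (trans (toℕ-next w) (sym (≡ᵇ-sound Guw))))

  open ColourChange

  Independent : VSet N → Set
  Independent S = ∀ u → S u ≡ true → S (next u) ≡ false

  -- In an independent set a coloured vertex u has the two uncoloured neighbours
  -- next u and prev u, which are distinct when N ≥ 3; so no vertex can force.
  independent-cannot-force : 2 ≤ m → (S : VSet N) → Independent S → ∀ u v → canForce G S u v ≡ false
  independent-cannot-force 2≤m S indep u v = ¬-not λ can →
    let Su      = forcer-coloured G S can
        next≡v  = forced-unique G S can (adjacent-next u) (indep u Su)
        prev≡v  = forced-unique G S can (subst (λ x → G x (prev u) ≡ true) (next-prev u) (adjacent-before (prev u)))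
                                        (prev-uncoloured Su)
    in next²≢id 2≤m u (trans (cong next (trans next≡v (sym prev≡v))) (next-prev u))
    where
    prev-uncoloured : S u ≡ true → S (prev u) ≡ false
    prev-uncoloured Su = ¬-not λ Sprev → not-¬ Su (subst (λ x → S x ≡ false) (next-prev u) (indep (prev u) Sprev))

  independent-stalls : 2 ≤ m → (S : VSet N) → Independent S → ∀ k v → iterate k G S v ≡ S v
  independent-stalls 2≤m S indep zero    v = refl
  independent-stalls 2≤m S indep (suc k) v =
    trans (independent-stalls 2≤m (step G S) indep′ k v) (unchanged v)
    where
    unchanged : ∀ v → step G S v ≡ S v
    unchanged v = step-stalled G S v (λ u → independent-cannot-force 2≤m S indep u v)
    indep′ : Independent (step G S)
    indep′ u Su = trans (unchanged (next u)) (indep u (trans (sym (unchanged u)) Su))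

  independent-not-zeroForcing : 2 ≤ m → (S : VSet N) → Independent S → isZeroForcing G S ≡ false
  independent-not-zeroForcing 2≤m S indep = ¬-not λ zf →
    let coloured : ∀ v → S v ≡ true
        coloured v = trans (sym (independent-stalls 2≤m S indep N v)) (allFin?-elim (closure G S) zf v)
    in not-¬ (coloured (next Fin.zero)) (indep Fin.zero (coloured Fin.zero))

  ArcColoured : VSet N → Fin N → ℕ → Set
  ArcColoured T a r = ∀ j → j ≤ r → T (walk j a) ≡ true

  -- The last vertex of a coloured arc of at least two vertices has its predecessor
  -- coloured, so it forces its successor: one round lengthens the arc.
  arc-grows : (T : VSet N) (a : Fin N) (r : ℕ) → ArcColoured T a (suc r) → ArcColoured (step G T) a (suc (suc r))
  arc-grows T a r arc j j≤r+2 with m≤n⇒m<n∨m≡n j≤r+2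
  ... | inj₁ j<r+2 = step-extensive G T (walk j a) (arc j (s≤s⁻¹ j<r+2))
  ... | inj₂ refl  = step-forces G T (arc (suc r) ≤-refl) (adjacent-next (walk (suc r) a)) others-coloured
    where
    others-coloured : ∀ w → G (walk (suc r) a) w ≡ true → T w ≡ true ⊎ w ≡ walk (suc (suc r)) a
    others-coloured w Gw with adjacent-cases Gw
    ... | inj₁ next≡w  = inj₂ (sym next≡w)
    ... | inj₂ nextw≡  = inj₁ (subst (λ x → T x ≡ true) (sym (next-injective nextw≡)) (arc r (n≤1+n r)))

  arc-after : (k : ℕ) (T : VSet N) (a : Fin N) (r : ℕ) → ArcColoured T a (suc r) →
              ArcColoured (iterate k G T) a (k + suc r)
  arc-after zero    T a r arc = arc
  arc-after (suc k) T a r arc =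
    subst (ArcColoured (iterate k G (step G T)) a) (+-suc k (suc r)) (arc-after k (step G T) a (suc r) (arc-grows T a r arc))

  adjacent-pair-zeroForcing : (S : VSet N) (a : Fin N) → S a ≡ true → S (next a) ≡ true → isZeroForcing G S ≡ true
  adjacent-pair-zeroForcing S a Sa Snext = allFin?-intro (closure G S) coloured
    where
    start : ArcColoured S a 1
    start zero          _           = Sa
    start (suc zero)    _           = Snext
    start (suc (suc j)) (s≤s ())
    coloured : ∀ v → closure G S v ≡ true
    coloured v with walk-reaches a v
    ... | j , j≤m , refl = arc-after N S a 0 start j (≤-trans j≤m (≤-trans (n≤1+n m) (m≤m+n N 1)))

  open IndependentStrings

  -- The string of S followed by the bit of vertex 0 again: consecutive positions
  -- of this string are exactly the consecutive vertices of the cycle.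
  closed : VSet N → List Bool
  closed S = toList S ++ S Fin.zero ∷ []

  bitAt-next : (S : VSet N) (u : Fin N) → bitAt (closed S) (suc (toℕ u)) ≡ S (next u)
  bitAt-next S u with m≤n⇒m<n∨m≡n (s≤s⁻¹ (toℕ<n u))
  ... | inj₁ u<m = begin
    bitAt (closed S) (suc (toℕ u))  ≡⟨ cong (bitAt (closed S)) (sym toℕ-next-u) ⟩
    bitAt (closed S) (toℕ (next u)) ≡⟨ bitAt-vertex S (S Fin.zero) (next u) ⟩
    S (next u)                                         ∎
    where
    open ≡-Reasoning
    toℕ-next-u : toℕ (next u) ≡ suc (toℕ u)
    toℕ-next-u = trans (toℕ-next u) (m<n⇒m%n≡m (s≤s u<m))
  ... | inj₂ u≡m = begin
    bitAt (closed S) (suc (toℕ u))  ≡⟨ cong (λ x → bitAt (closed S) (suc x)) u≡m ⟩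
    bitAt (closed S) N              ≡⟨ bitAt-last N S (S Fin.zero) ⟩
    S Fin.zero                                         ≡⟨ cong S (toℕ-injective toℕ-next-u) ⟨
    S (next u)                                         ∎
    where
    open ≡-Reasoning
    toℕ-next-u : toℕ (next u) ≡ 0
    toℕ-next-u = trans (toℕ-next u) (trans (cong (λ x → suc x % N) u≡m) (n%n≡0 N))

  independent-from-string : (S : VSet N) → cycleIndependent (toList S) ≡ true → Independent S
  independent-from-string S ind u Su = ¬-not λ Snext →
    not-¬ ind (witness-dependent (S Fin.zero) (toList (λ v → S (Fin.suc v))) (S Fin.zero) (toℕ u)
                 (trans (bitAt-vertex S (S Fin.zero) u) Su) (trans (bitAt-next S u) Snext))

  adjacent-pair-from-string : (S : VSet N) → cycleIndependent (toList S) ≡ false →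
                              Σ (Fin N) λ a → S a ≡ true × S (next a) ≡ true
  adjacent-pair-from-string S dep
    with dependent-witness (S Fin.zero) (toList (λ v → S (Fin.suc v))) (S Fin.zero) dep
  ... | j , bj , bj+1 with j <? N
  ...   | yes j<N = a , trans (sym (bitAt-vertex S (S Fin.zero) a)) (trans (cong (bitAt (closed S)) toℕ-a) bj)
                      , trans (sym (bitAt-next S a)) (trans (cong (λ x → bitAt (closed S) (suc x)) toℕ-a) bj+1)
    where
    a = fromℕ< j<N
    toℕ-a : toℕ a ≡ j
    toℕ-a = toℕ-fromℕ< j<N
  ...   | no  j≮N = contradiction (trans (sym (bitAt-beyond N S (S Fin.zero) (s≤s (≮⇒≥ j≮N)))) bj+1) λ ()

  zeroForcing-characterisation : 2 ≤ m → (S : VSet N) → isZeroForcing G S ≡ not (cycleIndependent (toList S))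
  zeroForcing-characterisation 2≤m S with cycleIndependent (toList S) in ind
  ... | true  = independent-not-zeroForcing 2≤m S (independent-from-string S ind)
  ... | false with adjacent-pair-from-string S ind
  ...   | a , Sa , Snext = adjacent-pair-zeroForcing S a Sa Snext

module ZeroForcingCount where
  open import Data.Bool using (_∧_; not)
  open import Data.Bool.Properties using (∧-comm)
  open import Data.Nat using (ℕ; zero; suc; _+_; _≤_; s≤s; _≡ᵇ_)
  open import Data.Nat.Properties using (+-cancelʳ-≡; *-identityˡ; *-identityʳ)
  open import Data.Nat.Combinatorics using (_C_; nC1≡n)
  open import Data.Vec.Functional using (toList)
  open import Relation.Binary.PropositionalEquality
  open BitStrings
  open IndependentStrings

  -- Every i-set of C_{m+1} (m ≥ 2) is either zero forcing or independent:
  -- z(C_{m+1}; i) + (number of independent i-sets) = C(m+1, i).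
  zfCount+cycleCount : (m : ℕ) → 2 ≤ m → (i : ℕ) →
                       zfCount (cycleG (suc m)) i + cycleCount (suc m) i ≡ suc m C i
  zfCount+cycleCount m 2≤m i = begin
    zfCount (cycleG N) i + cycleCount N i
      ≡⟨ cong (_+ cycleCount N i) zfCount-as-strings ⟩
    count (λ l → (ones l ≡ᵇ i) ∧ not (cycleIndependent l)) (bitStrings N) + cycleCount N i
      ≡⟨ count-partition (λ l → ones l ≡ᵇ i) cycleIndependent (bitStrings N) ⟩
    count (λ l → ones l ≡ᵇ i) (bitStrings N)
      ≡⟨ count-ones N i ⟩
    N C i ∎
    where
    open ≡-Reasoning
    open Cycle m using (N; G; zeroForcing-characterisation)
    reorder : ∀ S → (isZeroForcing G S ∧ (size S ≡ᵇ i)) ≡ ((ones (toList S) ≡ᵇ i) ∧ not (cycleIndependent (toList S)))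
    reorder S rewrite zeroForcing-characterisation 2≤m S | size≡ones S =
      ∧-comm (not (cycleIndependent (toList S))) (ones (toList S) ≡ᵇ i)
    zfCount-as-strings : zfCount G i ≡ count (λ l → (ones l ≡ᵇ i) ∧ not (cycleIndependent l)) (bitStrings N)
    zfCount-as-strings = begin
      zfCount G i
        ≡⟨ length-filter≡count (λ S → isZeroForcing G S ∧ (size S ≡ᵇ i)) (allSets N) ⟩
      count (λ S → isZeroForcing G S ∧ (size S ≡ᵇ i)) (allSets N)
        ≡⟨ count-cong reorder (allSets N) ⟩
      count (λ S → (ones (toList S) ≡ᵇ i) ∧ not (cycleIndependent (toList S))) (allSets N)
        ≡⟨ count-allSets N (λ l → (ones l ≡ᵇ i) ∧ not (cycleIndependent l)) ⟩
      count (λ l → (ones l ≡ᵇ i) ∧ not (cycleIndependent l)) (bitStrings N) ∎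

  -- No single vertex is zero forcing: all N singletons are independent sets.
  zfCount-singletons : (m : ℕ) → 2 ≤ m → zfCount (cycleG (suc m)) 1 ≡ 0
  zfCount-singletons zero           ()
  zfCount-singletons (suc zero)     (s≤s ())
  zfCount-singletons (suc (suc k)) 2≤m = +-cancelʳ-≡ (cycleCount N 1) (zfCount (cycleG N) 1) 0 (begin
    zfCount (cycleG N) 1 + cycleCount N 1  ≡⟨ zfCount+cycleCount (suc (suc k)) 2≤m 1 ⟩
    N C 1                                  ≡⟨ nC1≡n N ⟩
    N                                      ≡⟨ singletons ⟨
    0 + cycleCount N 1                     ∎)
    where
    open ≡-Reasoning
    N = suc (suc (suc k))
    singletons : cycleCount N 1 ≡ N
    singletons = trans (sym (*-identityˡ _)) (trans (cycleCount-identity (suc k) 0) (*-identityʳ N))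

module RationalArithmetic where
  open import Data.Nat as ℕ using (ℕ; suc)
  open import Data.Integer as ℤ using (ℤ; +_)
  import Data.Integer.Properties as ℤ
  open import Data.Integer.Tactic.RingSolver using (solve-∀)
  open import Data.Rational using (ℚ; _/_; _-_; _*_; -_; toℚᵘ)
  open import Data.Rational.Properties using (toℚᵘ-injective; toℚᵘ-fromℚᵘ; toℚᵘ-homo-+; toℚᵘ-homo‿-; toℚᵘ-homo-*)
  import Data.Rational.Unnormalised as ℚᵘ
  open import Data.Rational.Unnormalised using (mkℚᵘ; *≡*; _≃_)
  import Data.Rational.Unnormalised.Properties as ℚᵘ
  open import Relation.Binary.PropositionalEquality

  quotient : (c n b i : ℕ) → suc i ℕ.* c ≡ n ℕ.* b → (mkℚᵘ (+ n) i ℚᵘ.* mkℚᵘ (+ b) 0) ≃ mkℚᵘ (+ c) 0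
  quotient c n b i e = *≡* (begin
    (+ n ℤ.* + b) ℤ.* + 1        ≡⟨ ℤ.*-identityʳ _ ⟩
    + n ℤ.* + b                  ≡⟨ ℤ.pos-* n b ⟨
    + (n ℕ.* b)                  ≡⟨ cong +_ e ⟨
    + (suc i ℕ.* c)              ≡⟨ ℤ.pos-* (suc i) c ⟩
    + suc i ℤ.* + c              ≡⟨ swap (+ suc i) (+ c) ⟩
    + c ℤ.* (+ suc i ℤ.* + 1)    ∎)
    where
    open ≡-Reasoning
    swap : ∀ x y → x ℤ.* y ≡ y ℤ.* (x ℤ.* + 1)
    swap = solve-∀

  difference : (z c : ℕ) → (mkℚᵘ (+ (z ℕ.+ c)) 0 ℚᵘ.- mkℚᵘ (+ c) 0) ≃ mkℚᵘ (+ z) 0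
  difference z c = *≡* (begin
    (+ (z ℕ.+ c) ℤ.* + 1 ℤ.+ ℤ.- (+ c) ℤ.* + 1) ℤ.* + 1
      ≡⟨ cong (λ x → (x ℤ.* + 1 ℤ.+ ℤ.- (+ c) ℤ.* + 1) ℤ.* + 1) (ℤ.pos-+ z c) ⟩
    ((+ z ℤ.+ + c) ℤ.* + 1 ℤ.+ ℤ.- (+ c) ℤ.* + 1) ℤ.* + 1
      ≡⟨ cancel (+ z) (+ c) ⟩
    + z ℤ.* + 1 ∎)
    where
    open ≡-Reasoning
    cancel : ∀ x y → ((x ℤ.+ y) ℤ.* + 1 ℤ.+ ℤ.- y ℤ.* + 1) ℤ.* + 1 ≡ x ℤ.* + 1
    cancel = solve-∀

  toℚᵘ-/ : (x : ℤ) (d : ℕ) → toℚᵘ (x / suc d) ≃ mkℚᵘ x d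
  toℚᵘ-/ x d = toℚᵘ-fromℚᵘ (mkℚᵘ x d)

  toℚᵘ-homo-difference : (p q r : ℚ) → toℚᵘ (p - q * r) ≃ toℚᵘ p ℚᵘ.- toℚᵘ q ℚᵘ.* toℚᵘ r
  toℚᵘ-homo-difference p q r =
    ℚᵘ.≃-trans (toℚᵘ-homo-+ p (- (q * r)))
      (ℚᵘ.+-congʳ (toℚᵘ p) (ℚᵘ.≃-trans (toℚᵘ-homo‿- (q * r)) (ℚᵘ.-‿cong (toℚᵘ-homo-* q r))))

  complement-formula : (z c C n b i : ℕ) → z ℕ.+ c ≡ C → suc i ℕ.* c ≡ n ℕ.* b →
                       (+ z) / 1 ≡ ((+ C) / 1) - (((+ n) / suc i) * ((+ b) / 1))
  complement-formula z c .(z ℕ.+ c) n b i refl e = toℚᵘ-injective (begin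
    toℚᵘ ((+ z) / 1)
      ≈⟨ toℚᵘ-/ (+ z) 0 ⟩
    mkℚᵘ (+ z) 0
      ≈⟨ difference z c ⟨
    mkℚᵘ (+ (z ℕ.+ c)) 0 ℚᵘ.- mkℚᵘ (+ c) 0
      ≈⟨ ℚᵘ.+-congʳ (mkℚᵘ (+ (z ℕ.+ c)) 0) (ℚᵘ.-‿cong (quotient c n b i e)) ⟨
    mkℚᵘ (+ (z ℕ.+ c)) 0 ℚᵘ.- mkℚᵘ (+ n) i ℚᵘ.* mkℚᵘ (+ b) 0
      ≈⟨ ℚᵘ.+-cong (toℚᵘ-/ (+ (z ℕ.+ c)) 0) (ℚᵘ.-‿cong (ℚᵘ.*-cong (toℚᵘ-/ (+ n) i) (toℚᵘ-/ (+ b) 0))) ⟨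
    toℚᵘ ((+ (z ℕ.+ c)) / 1) ℚᵘ.- toℚᵘ ((+ n) / suc i) ℚᵘ.* toℚᵘ ((+ b) / 1)
      ≈⟨ toℚᵘ-homo-difference ((+ (z ℕ.+ c)) / 1) ((+ n) / suc i) ((+ b) / 1) ⟨
    toℚᵘ (((+ (z ℕ.+ c)) / 1) - (((+ n) / suc i) * ((+ b) / 1))) ∎)
    where open ℚᵘ.≃-Reasoning

module IntegerBinomial where
  open import Data.Nat using (ℕ; suc; _*_; _∸_; _≤_; z≤n; s≤s)
  open import Data.Nat.Properties using (+-∸-assoc; n∸n≡0; m≤n⇒m∸n≡0; n≤1+n; m≤n⇒m<n∨m≡n)
  open import Data.Nat.Combinatorics using (_C_)
  open import Data.Integer as ℤ using (+_)
  open import Data.Integer.Properties using (⊖-≥)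
  open import Data.Sum using (inj₁; inj₂)
  open import Relation.Binary.PropositionalEquality
  open IndependentStrings using (cycleCount; cycleCount-identity)

  -- The binomial of the statement with top (n+2) − (i+1) − 1, which is −1 only when i = n+1,
  -- agrees with C(n − i, i).
  binomℤ-top : (n i : ℕ) → i ≤ suc n → binomℤ ((+ suc (suc n)) ℤ.- (+ suc i) ℤ.- (+ 1)) i ≡ (n ∸ i) C i
  binomℤ-top n i i≤n+1 rewrite ⊖-≥ (s≤s i≤n+1) with m≤n⇒m<n∨m≡n i≤n+1
  ... | inj₁ (s≤s i≤n) rewrite +-∸-assoc 1 i≤n | ⊖-≥ (s≤s (z≤n {n ∸ i})) = refl
  ... | inj₂ refl      rewrite n∸n≡0 n | m≤n⇒m∸n≡0 (n≤1+n n) = refl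

  cycleCount-formula : (n i : ℕ) → i ≤ suc n →
                       suc i * cycleCount (suc (suc n)) (suc i)
                         ≡ suc (suc n) * binomℤ ((+ suc (suc n)) ℤ.- (+ suc i) ℤ.- (+ 1)) i
  cycleCount-formula n i i≤n+1 =
    trans (cycleCount-identity n i) (cong (suc (suc n) *_) (sym (binomℤ-top n i i≤n+1)))

open import Data.Nat using (ℕ; _≤_; _∸_; >-nonZero)
open import Data.Nat.Combinatorics using (_C_)
open import Data.Nat.Properties using (≤-trans; n≤1+n)
open import Data.Integer using (+_)
open import Data.Integer as ℤ using ()
open import Data.Rational using (ℚ; _/_; _-_; _*_)
open import Data.Product using (_×_)
open import Relation.Binary.PropositionalEquality using (_≡_)
open import Data.Nat using (zero; suc; s≤s; s≤s⁻¹)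
open import Data.Product using (_,_)
open ZeroForcingCount using (zfCount+cycleCount; zfCount-singletons)
open IndependentStrings using (cycleCount)
open RationalArithmetic using (complement-formula)
open IntegerBinomial using (cycleCount-formula)

proposition4p4 : (n : ℕ) → 3 ≤ n →
    (zfCount (cycleG n) 1 ≡ 0) ×
    ((i : ℕ) → (h : 2 ≤ i) → i ≤ n →
      (+ zfCount (cycleG n) i) / 1
        ≡ ((+ (n C i)) / 1)
          - (((+ n) / i) {{>-nonZero (≤-trans (n≤1+n 1) h)}}
              * ((+ binomℤ ((+ n) ℤ.- (+ i) ℤ.- (+ 1)) (i ∸ 1)) / 1)))
proposition4p4 zero               ()
proposition4p4 (suc zero)         (s≤s ())
proposition4p4 (suc (suc zero))   (s≤s (s≤s ()))
proposition4p4 n@(suc m@(suc (suc k))) (s≤s 2≤m) =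
  zfCount-singletons m 2≤m ,
  λ { zero () _
    ; (suc i) _ i+1≤n →
        complement-formula (zfCount (cycleG n) (suc i)) (cycleCount n (suc i)) (n C suc i) n
                           (binomℤ ((+ n) ℤ.- (+ suc i) ℤ.- (+ 1)) i) i
          (zfCount+cycleCount m 2≤m (suc i))
          (cycleCount-formula (suc k) i (s≤s⁻¹ i+1≤n)) }
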